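{- Let $G = \Gamma_2^{\infty} = \bigoplus_{i=1}^{\infty} \Gamma_2$ be the direct sum of countably infinitely many cyclic groups of order 2. Let $B$ be a subset of $G$. If $\hat{r}_B(x) \geq 2$ for some $x \in G$, then there exist elements $y, z \in G$ such that $\hat{r}_B(y) \geq 2$ and $\hat{r}_B(z) \geq 2$, and the elements $x$, $y$, $z$ are distinct.
   Context: For a subset $B$ of an additive abelian group $G$, the restricted representation function is $\hat{r}_B(x) = \mathrm{card}\{\{b,b'\} \subseteq B : b \neq b' \text{ and } b + b' = x\}$, the number of unordered pairs of distinct elements of $B$ summing to $x$. -}

module Defs where

open import Data.Bool using (Bool; false; true; _xor_)
open import Data.Nat using (ℕ; _≤_; _⊔_)
open import Data.Nat.Properties using (m⊔n≤o⇒m≤o; m⊔n≤o⇒n≤o)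
open import Data.Product using (Σ; _×_; _,_)
open import Data.Sum using (_⊎_)
open import Data.List using (List; length)
open import Data.List.Relation.Unary.All using (All)
open import Data.List.Relation.Unary.AllPairs using (AllPairs)
open import Relation.Nullary using (¬_)
open import Relation.Binary.PropositionalEquality using (_≡_; refl)

-- The group Γ₂^∞ = ⊕_{i ∈ ℕ} Z/2 : finitely supported Bool-valued sequences
-- (true = nonzero coordinate), with coordinatewise xor as addition.
record G : Set where
  constructor mkG
  field
    bits  : ℕ → Bool
    bound : ℕ
    supp  : ∀ i → bound ≤ i → bits i ≡ false
open G public

infix 4 _≈_
_≈_ : G → G → Set
x ≈ y = ∀ i → bits x i ≡ bits y i

private
  xor-ff : ∀ {a b} → a ≡ false → b ≡ false → (a xor b) ≡ false
  xor-ff refl refl = refl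

infixl 6 _+_
_+_ : G → G → G
x + y = mkG (λ i → bits x i xor bits y i) (bound x ⊔ bound y)
  (λ i le → xor-ff (supp x i (m⊔n≤o⇒m≤o (bound x) (bound y) le))
                   (supp y i (m⊔n≤o⇒n≤o (bound x) (bound y) le)))

Rep : (G → Set) → G → G × G → Set
Rep B x (b , b') = B b × B b' × ¬ (b ≈ b') × (b + b') ≈ x

SamePair : G × G → G × G → Set
SamePair (a , a') (b , b') = (a ≈ b × a' ≈ b') ⊎ (a ≈ b' × a' ≈ b)

-- r̂_B(x) ≥ k : there are k pairwise distinct unordered pairs {b,b'} ⊆ B,
-- b ≠ b', with b + b' = x.
r̂≥ : (G → Set) → G → ℕ → Set
r̂≥ B x k = Σ (List (G × G)) λ ps →
  length ps ≡ k × All (Rep B x) ps × AllPairs (λ p q → ¬ SamePair p q) ps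

-- If {a, b} and {c, d} are two different representations of x, then in an
-- elementary abelian 2-group a + b = c + d forces a + c = b + d and
-- a + d = b + c, so the crossed pairs {a, c}, {b, d} and {a, d}, {b, c}
-- represent y = a + c and z = a + d twice each.  Any coincidence among x, y, z
-- would, after cancelling a, identify two of a, b, c, d that the hypotheses
-- keep apart.
module Submission where

open import Defs
open import Algebra.Bundles using (CommutativeRing)
open import Data.Bool using (false; true; _xor_)
open import Data.Bool.Properties
  using (not-injective; xor-same; xor-comm; xor-∧-commutativeRing)
open import Algebra.Properties.CommutativeSemigroup
  (CommutativeRing.+-commutativeSemigroup xor-∧-commutativeRing)
  using () renaming (interchange to xor-interchange)
open import Data.List using ([]; _∷_)
open import Data.List.Relation.Unary.All using ([]; _∷_)
open import Data.List.Relation.Unary.AllPairs using ([]; _∷_)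
open import Data.Product using (Σ; _×_; _,_)
open import Data.Sum using (inj₁; inj₂)
open import Relation.Nullary using (¬_)
open import Relation.Binary.PropositionalEquality using (_≡_; refl; sym; trans; cong)
open Relation.Binary.PropositionalEquality.≡-Reasoning

xor≡false⇒≡ : ∀ p q → p xor q ≡ false → p ≡ q
xor≡false⇒≡ false q eq = sym eq
xor≡false⇒≡ true  q eq = sym (not-injective eq)

xor-cancelˡ : ∀ p q r → p xor q ≡ p xor r → q ≡ r
xor-cancelˡ false q r eq = eq
xor-cancelˡ true  q r eq = not-injective eq

xor-swap-middle : ∀ p q r s → p xor q ≡ r xor s → p xor r ≡ q xor s
xor-swap-middle p q r s eq = xor≡false⇒≡ (p xor r) (q xor s) (begin
  (p xor r) xor (q xor s) ≡⟨ xor-interchange p q r s ⟨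
  (p xor q) xor (r xor s) ≡⟨ cong (_xor (r xor s)) eq ⟩
  (r xor s) xor (r xor s) ≡⟨ xor-same (r xor s) ⟩
  false                   ∎)

-- Since _≈_ unfolds to a pointwise statement about bits, the elements of G
-- cannot be inferred from a proof of a ≈ b and are passed explicitly.

≈-sym : ∀ a b → a ≈ b → b ≈ a
≈-sym a b a≈b i = sym (a≈b i)

≈-trans : ∀ a b c → a ≈ b → b ≈ c → a ≈ c
≈-trans a b c a≈b b≈c i = trans (a≈b i) (b≈c i)

+-comm : ∀ a b → a + b ≈ b + a
+-comm a b i = xor-comm (bits a i) (bits b i)

+-congʳ : ∀ a b c → a ≈ b → a + c ≈ b + c
+-congʳ a b c a≈b i = cong (_xor bits c i) (a≈b i)

+-cancelˡ : ∀ a b c → a + b ≈ a + c → b ≈ c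
+-cancelˡ a b c eq i = xor-cancelˡ (bits a i) (bits b i) (bits c i) (eq i)

+-swap-middle : ∀ a b c d → a + b ≈ c + d → a + c ≈ b + d
+-swap-middle a b c d eq i =
  xor-swap-middle (bits a i) (bits b i) (bits c i) (bits d i) (eq i)

¬SamePair-swapʳ : ∀ p a b → ¬ SamePair p (a , b) → ¬ SamePair p (b , a)
¬SamePair-swapʳ p a b ¬same (inj₁ (u , v)) = ¬same (inj₂ (u , v))
¬SamePair-swapʳ p a b ¬same (inj₂ (u , v)) = ¬same (inj₁ (u , v))

¬SamePair-swap : ∀ a b c d →
                 ¬ SamePair (a , b) (c , d) → ¬ SamePair (b , a) (d , c)
¬SamePair-swap a b c d ¬same (inj₁ (b≈d , a≈c)) = ¬same (inj₁ (a≈c , b≈d))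
¬SamePair-swap a b c d ¬same (inj₂ (b≈c , a≈d)) = ¬same (inj₂ (a≈d , b≈c))

module Representations (B : G → Set) (x : G) where

  Rep-swap : ∀ a b → Rep B x (a , b) → Rep B x (b , a)
  Rep-swap a b (Ba , Bb , a≉b , a+b≈x) =
    Bb , Ba , (λ b≈a → a≉b (≈-sym b a b≈a)) ,
    ≈-trans (b + a) (a + b) x (+-comm b a) a+b≈x

  Rep-sums-≈ : ∀ a b c d → Rep B x (a , b) → Rep B x (c , d) → a + b ≈ c + d
  Rep-sums-≈ a b c d (_ , _ , _ , a+b≈x) (_ , _ , _ , c+d≈x) =
    ≈-trans (a + b) x (c + d) a+b≈x (≈-sym (c + d) x c+d≈x)

  Rep-first-≉ : ∀ a b c d → Rep B x (a , b) → Rep B x (c , d) →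
                ¬ SamePair (a , b) (c , d) → ¬ (a ≈ c)
  Rep-first-≉ a b c d ab cd ab≠cd a≈c =
    ab≠cd (inj₁ (a≈c , +-cancelˡ a b d a+b≈a+d))
    where
    a+b≈a+d : a + b ≈ a + d
    a+b≈a+d = ≈-trans (a + b) (c + d) (a + d)
      (Rep-sums-≈ a b c d ab cd) (+-congʳ c a d (≈-sym a c a≈c))

  Rep-second-≉ : ∀ a b c d → Rep B x (a , b) → Rep B x (c , d) →
                 ¬ SamePair (a , b) (c , d) → ¬ (b ≈ d)
  Rep-second-≉ a b c d ab cd ab≠cd =
    Rep-first-≉ b a d c (Rep-swap a b ab) (Rep-swap c d cd)
      (¬SamePair-swap a b c d ab≠cd)

  crossed-r̂≥2 : ∀ a b c d → Rep B x (a , b) → Rep B x (c , d) →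
                ¬ SamePair (a , b) (c , d) → r̂≥ B (a + c) 2
  crossed-r̂≥2 a b c d ab@(Ba , Bb , a≉b , _) cd@(Bc , Bd , _ , _) ab≠cd =
    ((a , c) ∷ (b , d) ∷ []) , refl ,
    ((Ba , Bc , Rep-first-≉ a b c d ab cd ab≠cd , λ _ → refl) ∷
     (Bb , Bd , Rep-second-≉ a b c d ab cd ab≠cd ,
      ≈-sym (a + c) (b + d)
        (+-swap-middle a b c d (Rep-sums-≈ a b c d ab cd))) ∷ []) ,
    ((ac≠bd ∷ []) ∷ [] ∷ [])
    where
    ac≠bd : ¬ SamePair (a , c) (b , d)
    ac≠bd (inj₁ (a≈b , _)) = a≉b a≈b
    ac≠bd (inj₂ (a≈d , _)) =
      Rep-first-≉ a b d c ab (Rep-swap c d cd)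
        (¬SamePair-swapʳ (a , b) c d ab≠cd) a≈d

lemma3 : (B : G → Set) (x : G) → r̂≥ B x 2 →
    Σ G λ y → Σ G λ z → r̂≥ B y 2 × r̂≥ B z 2 ×
    ¬ (x ≈ y) × ¬ (y ≈ z) × ¬ (x ≈ z)
lemma3 B x (((a , b) ∷ (c , d) ∷ []) , refl ,
            (ab@(_ , _ , _ , a+b≈x) ∷ cd@(_ , _ , c≉d , _) ∷ []) ,
            ((ab≠cd ∷ []) ∷ [] ∷ [])) =
  a + c , a + d ,
  crossed-r̂≥2 a b c d ab cd ab≠cd , crossed-r̂≥2 a b d c ab dc ab≠dc ,
  (λ x≈a+c → Rep-second-≉ a b d c ab dc ab≠dc (x≈a+⇒b≈ c x≈a+c)) ,
  (λ a+c≈a+d → c≉d (+-cancelˡ a c d a+c≈a+d)) ,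
  (λ x≈a+d → Rep-second-≉ a b c d ab cd ab≠cd (x≈a+⇒b≈ d x≈a+d))
  where
  open Representations B x
  dc : Rep B x (d , c)
  dc = Rep-swap c d cd
  ab≠dc : ¬ SamePair (a , b) (d , c)
  ab≠dc = ¬SamePair-swapʳ (a , b) c d ab≠cd
  x≈a+⇒b≈ : ∀ e → x ≈ a + e → b ≈ e
  x≈a+⇒b≈ e x≈a+e = +-cancelˡ a b e (≈-trans (a + b) x (a + e) a+b≈x x≈a+e)
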